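{- Let $q>1$ and $n\geq 1$. Every optimal strategy (i.e., one achieving the maximum possible success probability) for the New Hats-on-a-line Game with $q$ hat colours and $n$ players is a restricted strategy.
   Context: The New Hats-on-a-line Game with $q$ hat colours and $n$ players: players $P_1,\dots,P_n$ stand in a line. Each player receives a hat whose colour is chosen uniformly at random from a fixed set of $q$ colours, independently of the other hats. Player $P_i$ sees exactly the hats of $P_{i+1},\dots,P_n$. The players respond one at a time in the order $P_1,P_2,\dots,P_n$; each response is either a guess of the player's own hat colour or a pass, and every player hears all earlier responses. Apart from agreeing on a strategy beforehand, no communication is allowed. A (deterministic) strategy specifies, for each player, the response as a function of the hats that player sees and the responses that player has heard. The players win if at least one player guesses correctly and no player guesses incorrectly; the success probability of a strategy is the probability of winning over the random hat assignment. A strategy is called restricted if, for every hat configuration, any guess made by any player other than $P_1$ is correct. -}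

module Defs where

open import Data.Nat using (ℕ; zero; suc; _+_; _∸_; _≤_; _<_)
open import Data.Nat.Properties using (+-identityʳ; +-suc)
open import Data.Fin using (Fin; zero; suc; toℕ; _≟_)
open import Data.Maybe using (Maybe; just; nothing)
open import Data.Product using (_×_; _,_; proj₁)
open import Data.Unit using (⊤; tt)
open import Data.Empty using (⊥)
open import Data.Vec using (Vec; []; _∷_; _∷ʳ_; lookup)
open import Data.Vec.Relation.Unary.Any using (Any; any?)
open import Data.Vec.Relation.Unary.All using (All; all?)
open import Data.List using (List; []; _∷_; concatMap; map; length; filter; allFin)
open import Relation.Binary.PropositionalEquality using (_≡_; _≢_; subst; sym)
open import Relation.Nullary using (Dec; yes; no; ¬_)
open import Relation.Nullary.Decidable using (_×-dec_; ¬?)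

-- A response: a guess of one's own colour (just c) or a pass (nothing).
Resp : ℕ → Set
Resp q = Maybe (Fin q)

-- A hat configuration: the hat colours of P_1, …, P_n (in this order).
Config : ℕ → ℕ → Set
Config q n = Vec (Fin q) n

-- Player i (i = 0 is P_1) responds as a
-- function of the hats it sees, i.e. those of the n ∸ (i+1) players behind
-- it (in line order), and of the i responses it has heard (in order).
Strategy : ℕ → ℕ → Set
Strategy q n = (i : Fin n) → Vec (Fin q) (n ∸ suc (toℕ i)) → Vec (Resp q) (toℕ i) → Resp q

playFrom : ∀ {q n} (k : ℕ) →
           ((i : Fin n) → Vec (Fin q) (n ∸ suc (toℕ i)) → Vec (Resp q) (k + toℕ i) → Resp q) →
           Vec (Resp q) k → Vec (Fin q) n → Vec (Resp q × Fin q) n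
playFrom k σ h [] = []
playFrom {q} {suc n} k σ h (x ∷ xs) = (r , x) ∷ playFrom (suc k) σ′ (h ∷ʳ r) xs
  where
  r : Resp q
  r = σ zero xs (subst (Vec (Resp q)) (sym (+-identityʳ k)) h)
  σ′ : (i : Fin n) → Vec (Fin q) (n ∸ suc (toℕ i)) → Vec (Resp q) (suc k + toℕ i) → Resp q
  σ′ i v hh = σ (suc i) v (subst (Vec (Resp q)) (sym (+-suc k (toℕ i))) hh)

play : ∀ {q n} → Strategy q n → Config q n → Vec (Resp q × Fin q) n
play σ c = playFrom 0 σ [] c

CorrectGuess : ∀ {q} → Resp q × Fin q → Set
CorrectGuess (nothing , x) = ⊥
CorrectGuess (just g , x) = g ≡ x

NotWrong : ∀ {q} → Resp q × Fin q → Set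
NotWrong (nothing , x) = ⊤
NotWrong (just g , x) = g ≡ x

correct? : ∀ {q} (o : Resp q × Fin q) → Dec (CorrectGuess o)
correct? (nothing , x) = no (λ ())
correct? (just g , x) = g ≟ x

notWrong? : ∀ {q} (o : Resp q × Fin q) → Dec (NotWrong o)
notWrong? (nothing , x) = yes tt
notWrong? (just g , x) = g ≟ x

Wins : ∀ {q n} → Strategy q n → Config q n → Set
Wins σ c = Any CorrectGuess (play σ c) × All NotWrong (play σ c)

wins? : ∀ {q n} (σ : Strategy q n) (c : Config q n) → Dec (Wins σ c)
wins? σ c = any? correct? (play σ c) ×-dec all? notWrong? (play σ c)

allConfigs : ∀ q n → List (Config q n)
allConfigs q zero = [] ∷ []
allConfigs q (suc n) = concatMap (λ x → map (x ∷_) (allConfigs q n)) (allFin q)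

-- The success probability of σ is
-- winCount σ / q^n (hats uniform and independent), so comparing success
-- probabilities for fixed q, n is the same as comparing winCount.
winCount : ∀ {q n} → Strategy q n → ℕ
winCount {q} {n} σ = length (filter (wins? σ) (allConfigs q n))

Optimal : ∀ {q n} → Strategy q n → Set
Optimal {q} {n} σ = (τ : Strategy q n) → winCount τ ≤ winCount σ

Restricted : ∀ {q n} → Strategy q n → Set
Restricted {q} {n} σ = (c : Config q n) (i : Fin n) → 0 < toℕ i → NotWrong (lookup (play σ c) i)

-- Suppose some player after P_1 guesses wrongly on the configuration x ∷ r
-- under σ.  That player's response does not depend on P_1's hat, so σ loses
-- on every x ∷ r.  Modify σ so that P_1, on seeing r, makes a guess (σ's
-- guess if it has one), and so that whenever P_1 guesses everybody else
-- passes.  The new strategy wins wherever σ wins: off r, a winning guess of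
-- P_1 is correct and is now followed by passes, and a pass of P_1 leaves the
-- play unchanged.  It also wins on the configuration where P_1's guess at r
-- is correct, on which σ loses; so σ was not optimal.
module Submission where

open import Defs
open import Data.Nat using (ℕ; zero; suc; _+_; _∸_; _<_; _≤_)
open import Data.Nat.Properties using (+-identityʳ; +-suc; <⇒≱)
open import Data.Fin using (Fin; zero; suc; toℕ)
open import Data.Fin.Properties using () renaming (_≟_ to _≟ᶠ_)
open import Data.Maybe using (just; nothing; Is-just; Is-nothing)
open import Data.Maybe.Relation.Unary.All using (nothing; just)
open import Data.Maybe.Relation.Unary.Any using (just)
open import Data.Product using (_×_; _,_; proj₂)
open import Data.Unit using (tt)
open import Data.Empty using (⊥; ⊥-elim)
open import Data.Vec using (Vec; []; _∷_; _∷ʳ_; lookup)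
open import Data.Vec.Properties using (≡-dec)
open import Data.Vec.Relation.Unary.Any using (Any; here)
open import Data.Vec.Relation.Unary.All using (All; []; _∷_)
open import Data.Vec.Relation.Unary.All.Properties using (lookup⁺)
open import Data.List using ([]; _∷_; filter; length; map)
open import Data.List.Properties using (filter-accept; filter-reject; filter-notAll)
open import Data.List.Membership.Propositional using (_∈_; lose)
open import Data.List.Membership.Propositional.Properties using (∈-map⁺; ∈-concatMap⁺; ∈-allFin; ∈-filter⁺)
import Data.List.Relation.Unary.Any as ListAny
open import Relation.Binary.PropositionalEquality using (_≡_; refl; sym; trans; cong; subst)
open import Relation.Nullary using (Dec; yes; no; ¬_)
open import Relation.Unary using (Decidable)

module _ {A : Set} {P Q : A → Set} (P? : Decidable P) (Q? : Decidable Q)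
         (P⇒Q : ∀ a → P a → Q a) where

  filter-absorbs : ∀ xs → filter P? (filter Q? xs) ≡ filter P? xs
  filter-absorbs [] = refl
  filter-absorbs (a ∷ xs) with Q? a | P? a
  ... | yes _ | yes pa = trans (filter-accept P? pa) (cong (a ∷_) (filter-absorbs xs))
  ... | yes _ | no ¬pa = trans (filter-reject P? ¬pa) (filter-absorbs xs)
  ... | no ¬qa | yes pa = ⊥-elim (¬qa (P⇒Q a pa))
  ... | no _ | no _ = filter-absorbs xs

  length-filter-< : ∀ {a xs} → a ∈ xs → Q a → ¬ P a →
                    length (filter P? xs) < length (filter Q? xs)
  length-filter-< {a} {xs} a∈xs qa ¬pa =
    subst (_< length (filter Q? xs)) (cong length (filter-absorbs xs))
      (filter-notAll P? (filter Q? xs) (lose (∈-filter⁺ Q? a∈xs qa) ¬pa))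

∈-allConfigs : ∀ q n (c : Config q n) → c ∈ allConfigs q n
∈-allConfigs q zero [] = ListAny.here refl
∈-allConfigs q (suc n) (x ∷ xs) =
  ∈-concatMap⁺ (λ y → map (y ∷_) (allConfigs q n))
    (ListAny.map (λ { refl → ∈-map⁺ (x ∷_) (∈-allConfigs q n xs) }) (∈-allFin x))

StrategyAfter : ℕ → ℕ → ℕ → Set
StrategyAfter q k n = (i : Fin n) → Vec (Fin q) (n ∸ suc (toℕ i)) → Vec (Resp q) (k + toℕ i) → Resp q

FirstResponse : ∀ {q k} → (Resp q → Set) → Vec (Resp q) k → Set
FirstResponse P [] = ⊥
FirstResponse P (r ∷ _) = P r

firstResponse-subst : ∀ {q k k′} {P : Resp q → Set} (eq : k ≡ k′) (h : Vec (Resp q) k) →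
                      FirstResponse P h → FirstResponse P (subst (Vec (Resp q)) eq h)
firstResponse-subst refl h p = p

firstResponse-∷ʳ : ∀ {q k} {P : Resp q → Set} (h : Vec (Resp q) k) r →
                   FirstResponse P h → FirstResponse P (h ∷ʳ r)
firstResponse-∷ʳ (_ ∷ _) r p = p

playFrom-cong : ∀ {q n} k {P : Resp q → Set} {σ τ : StrategyAfter q k n} (h : Vec (Resp q) k) xs →
                FirstResponse P h →
                (∀ i v h′ → FirstResponse P h′ → σ i v h′ ≡ τ i v h′) →
                playFrom k σ h xs ≡ playFrom k τ h xs
playFrom-cong k h [] _ _ = refl
playFrom-cong {q} k {σ = σ} h (x ∷ xs) ph σ≗τ
  rewrite σ≗τ zero xs (subst (Vec (Resp q)) (sym (+-identityʳ k)) h)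
                 (firstResponse-subst (sym (+-identityʳ k)) h ph) =
  cong (_ ∷_) (playFrom-cong (suc k) (h ∷ʳ _) xs (firstResponse-∷ʳ h _ ph)
    (λ i v h′ p → σ≗τ (suc i) v _ (firstResponse-subst (sym (+-suc k (toℕ i))) h′ p)))

silent : ∀ {q k n} → StrategyAfter q k n
silent _ _ _ = nothing

playFrom-silent-notWrong : ∀ {q n} k (h : Vec (Resp q) k) (xs : Vec (Fin q) n) →
                           All NotWrong (playFrom k silent h xs)
playFrom-silent-notWrong k h [] = []
playFrom-silent-notWrong k h (x ∷ xs) = tt ∷ playFrom-silent-notWrong (suc k) (h ∷ʳ nothing) xs

guess-or : ∀ {q} → Fin q → Resp q → Fin q
guess-or d nothing = d
guess-or d (just g) = g

module Improvement {q m : ℕ} (σ : Strategy q (suc m)) (x₁ : Fin q) (r : Vec (Fin q) m) where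

  g₀ : Fin q
  g₀ = guess-or x₁ (σ zero r [])

  improved : Strategy q (suc m)
  improved zero v h with ≡-dec _≟ᶠ_ v r
  ... | yes _ = just g₀
  ... | no _ = σ zero v h
  improved (suc i) v (nothing ∷ h) = σ (suc i) v (nothing ∷ h)
  improved (suc i) v (just _ ∷ h) = nothing

  improved-first-off : ∀ {xs} → ¬ xs ≡ r → improved zero xs [] ≡ σ zero xs []
  improved-first-off {xs} xs≢r with ≡-dec _≟ᶠ_ xs r
  ... | yes xs≡r = ⊥-elim (xs≢r xs≡r)
  ... | no _ = refl

  improved-first-at : improved zero r [] ≡ just g₀
  improved-first-at with ≡-dec _≟ᶠ_ r r
  ... | yes _ = refl
  ... | no r≢r = ⊥-elim (r≢r refl)

  improved-after-pass : ∀ i v h → FirstResponse Is-nothing h → improved (suc i) v h ≡ σ (suc i) v h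
  improved-after-pass i v (nothing ∷ h) _ = refl
  improved-after-pass i v (just _ ∷ h) (just ())

  improved-after-guess : ∀ i v h → FirstResponse Is-just h → improved (suc i) v h ≡ nothing
  improved-after-guess i v (just _ ∷ h) _ = refl

  improved-wins-after-correct-guess : ∀ {x xs g} → improved zero xs [] ≡ just g → g ≡ x →
                                      Wins improved (x ∷ xs)
  improved-wins-after-correct-guess {xs = xs} {g} first g≡x rewrite first =
    here g≡x , g≡x ∷ subst (All NotWrong)
      (sym (playFrom-cong 1 (just g ∷ []) xs (just tt) improved-after-guess))
      (playFrom-silent-notWrong 1 (just g ∷ []) xs)

  improved-play-after-pass : ∀ {x xs} → ¬ xs ≡ r → σ zero xs [] ≡ nothing →
                             play improved (x ∷ xs) ≡ play σ (x ∷ xs)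
  improved-play-after-pass {xs = xs} xs≢r pass rewrite improved-first-off xs≢r | pass =
    cong (_ ∷_) (playFrom-cong 1 (nothing ∷ []) xs nothing improved-after-pass)

  module _ (i : Fin m) (wrong : ¬ NotWrong (lookup (play σ (x₁ ∷ r)) (suc i))) where

    -- P_(i+2) does not see P_1's hat, so its response at x ∷ r is
    -- definitionally the one at x₁ ∷ r.
    σ-loses-on-r : ∀ x → ¬ Wins σ (x ∷ r)
    σ-loses-on-r x (_ , notWrong) = wrong (lookup⁺ notWrong (suc i))

    improved-wins-if-σ-wins : ∀ c → Wins σ c → Wins improved c
    improved-wins-if-σ-wins (x ∷ xs) σ-wins = by-whether-r (≡-dec _≟ᶠ_ xs r)
      where
      by-first-response : ¬ xs ≡ r → ∀ resp → σ zero xs [] ≡ resp → Wins improved (x ∷ xs)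
      by-first-response xs≢r nothing pass =
        subst (λ o → Any CorrectGuess o × All NotWrong o)
          (sym (improved-play-after-pass xs≢r pass)) σ-wins
      by-first-response xs≢r (just g) guess =
        improved-wins-after-correct-guess (trans (improved-first-off xs≢r) guess)
          (subst (λ o → NotWrong (o , x)) guess (lookup⁺ (proj₂ σ-wins) zero))

      by-whether-r : Dec (xs ≡ r) → Wins improved (x ∷ xs)
      by-whether-r (yes refl) = ⊥-elim (σ-loses-on-r x σ-wins)
      by-whether-r (no xs≢r) = by-first-response xs≢r (σ zero xs []) refl

    winCount-< : winCount σ < winCount improved
    winCount-< = length-filter-< (wins? σ) (wins? improved) improved-wins-if-σ-wins
      (∈-allConfigs q (suc m) (g₀ ∷ r))
      (improved-wins-after-correct-guess improved-first-at refl)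
      (σ-loses-on-r g₀)

lemma4 : (q n : ℕ) → 1 < q → 1 ≤ n → (σ : Strategy q n) → Optimal σ → Restricted σ
lemma4 q zero _ _ σ _ [] ()
lemma4 q (suc m) _ _ σ _ c zero ()
lemma4 q (suc m) _ _ σ optimal (x₁ ∷ r) (suc i) _ with notWrong? (lookup (play σ (x₁ ∷ r)) (suc i))
... | yes notWrong = notWrong
... | no wrong = ⊥-elim (<⇒≱ (winCount-< i wrong) (optimal improved))
  where open Improvement σ x₁ r
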